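{- Every single-valued partial function $f:\subseteq\mathbb{N}^\mathbb{N}\to\mathbb{N}^\mathbb{N}$ is either continuous or effectively discontinuous.
   Context: $\Phi$ is the standard total representation of continuous partial functions on Baire space: $\Phi_q(p)=\sup_{w\sqsubseteq p}h(w)$ for the monotone word function $h$ whose graph is listed by $q$; every continuous partial function has an extension $\Phi_q$. $f$ is effectively discontinuous if there is a continuous total $D:\mathbb{N}^\mathbb{N}\to\mathbb{N}^\mathbb{N}$ with $D(q)\in\mathrm{dom}(f)$ and $\Phi_qD(q)\ne f(D(q))$ for all $q$ (counted as satisfied when $\Phi_qD(q)$ is undefined). -}

module Defs where

open import Data.Nat using (ℕ; zero; suc; _<_; _/_; _%_)
open import Data.Nat.Base using (_≡ᵇ_)
open import Data.Bool using (if_then_else_)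
open import Data.List using (List; []; _∷_; length)
open import Data.Product using (Σ; ∃; _×_; _,_; proj₁; proj₂)
open import Data.Unit using (⊤)
open import Data.Sum using (_⊎_)
open import Relation.Nullary using (¬_)
open import Relation.Binary.PropositionalEquality using (_≡_)

Baire : Set
Baire = ℕ → ℕ

AgreeUpTo : ℕ → Baire → Baire → Set
AgreeUpTo m x y = ∀ i → i < m → x i ≡ y i

_⊑_ : List ℕ → Baire → Set
[] ⊑ p = ⊤
(a ∷ w) ⊑ p = (a ≡ p 0) × (w ⊑ (λ i → p (suc i)))

record PartialFunction : Set₁ where
  field
    dom     : Baire → Set
    app     : (x : Baire) → dom x → Baire
    dom-ext : ∀ {x y} → (∀ i → x i ≡ y i) → dom x → dom y
    single-valued : ∀ {x y} (dx : dom x) (dy : dom y) →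
                    (∀ i → x i ≡ y i) → ∀ i → app x dx i ≡ app y dy i
open PartialFunction public

Continuous : PartialFunction → Set
Continuous f =
  ∀ x (dx : dom f x) (n : ℕ) → ∃ λ m → ∀ y (dy : dom f y) →
    AgreeUpTo m x y → AgreeUpTo n (app f x dx) (app f y dy)

ContinuousTotal : (Baire → Baire) → Set
ContinuousTotal D =
  ∀ q (n : ℕ) → ∃ λ m → ∀ q' → AgreeUpTo m q q' → AgreeUpTo n (D q) (D q')

-- Coding of pairs and words by natural numbers.
-- unpair n = (x , y) with n + 1 = 2^x * (2y + 1).

private
  v2 : ℕ → ℕ → ℕ × ℕ
  v2 zero m = (0 , m / 2)
  v2 (suc f) m =
    if (m % 2) ≡ᵇ 0
    then (suc (proj₁ (v2 f (m / 2))) , proj₂ (v2 f (m / 2)))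
    else (0 , m / 2)

unpair : ℕ → ℕ × ℕ
unpair n = v2 n (suc n)

-- decodeWord 0 = [], decodeWord (suc n) = a ∷ decodeWord b where unpair n = (a , b)
private
  dw : ℕ → ℕ → List ℕ
  dw zero _ = []
  dw (suc f) zero = []
  dw (suc f) (suc n) = proj₁ (unpair n) ∷ dw f (proj₂ (unpair n))

decodeWord : ℕ → List ℕ
decodeWord n = dw n n

-- An entry c of a listing codes the pair of words (w , v), meaning h(w) = v.
entryIn : ℕ → List ℕ
entryIn c = decodeWord (proj₁ (unpair c))

entryOut : ℕ → List ℕ
entryOut c = decodeWord (proj₂ (unpair c))

-- The representation Φ of continuous partial functions:
-- q lists (q i = 0: no entry, q i = suc c: the pair coded by c) the graph
-- of a word function h; Φ_q(p) = sup_{w ⊑ p} h(w).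
-- ΦGraph q p y  ⇔  Φ_q(p) is defined and equals y:
-- every listed value h(w) with w ⊑ p is a prefix of y, and these values
-- have unbounded length.

ΦGraph : Baire → Baire → Baire → Set
ΦGraph q p y =
  (∀ i c → q i ≡ suc c → entryIn c ⊑ p → entryOut c ⊑ y) ×
  (∀ n → ∃ λ i → ∃ λ c → (q i ≡ suc c) × (entryIn c ⊑ p) × (n < length (entryOut c)))

EffectivelyDiscontinuous : PartialFunction → Set
EffectivelyDiscontinuous f =
  Σ (Baire → Baire) λ D → ContinuousTotal D ×
    Σ (∀ q → dom f (D q)) λ dD →
      ∀ q → ¬ ΦGraph q (D q) (app f (D q) (dD q))

-- Classically, a discontinuous f has a point x, a precision n and points near m ∈ dom f
-- agreeing with x on m digits whose images differ from f x within n digits. The witness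
-- D q copies x until q lists an entry w ↦ v with w ⊑ x and n < |v|, say at index i; from
-- then on it is near (i + |w|) if v ⊑ f x (this still agrees with the i digits written
-- and extends w), and x otherwise. So D q j depends only on q 0 … q j, and the tests are
-- decided by excluded middle since continuity, not computability, is asked of D. If q
-- lists no such entry, Φ_q (D q) = Φ_q x lacks an n-th digit; otherwise Φ_q (D q) starts
-- with v, which in the first case would make f (near m) agree with f x on n < |v| digits
-- and in the second contradicts v ⋢ f x.
module Submission where

open import Defs
open import Level using (0ℓ)
open import Axiom.ExcludedMiddle using (ExcludedMiddle)
open import Axiom.DoubleNegationElimination using (em⇒dne)
open import Data.Bool using (if_then_else_)
open import Data.Empty using (⊥; ⊥-elim)
open import Data.List using ([]; _∷_; length)
open import Data.Maybe using (Maybe; just; nothing; maybe; _<∣>_)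
open import Data.Nat using (ℕ; zero; suc; _+_; _<_; _<?_; z≤n; s≤s)
open import Data.Nat.Properties
  using (≤-refl; <-trans; <-≤-trans; m<n⇒m<1+n; m<1+n⇒m<n∨m≡n; m≤m+n; m≤n+m; ≮⇒≥)
open import Data.Product using (Σ; ∃; _×_; _,_; proj₁; proj₂)
open import Data.Sum using (_⊎_; inj₁; inj₂)
open import Data.Unit using (tt)
open import Relation.Nullary using (¬_; Dec; yes; no; does; contradiction)
open import Relation.Nullary.Negation using (¬∃⟶∀¬)
open import Relation.Binary.PropositionalEquality
  using (_≡_; _≗_; refl; sym; trans; cong; cong₂; cong-app; subst)

¬∀⇒∃¬ : ExcludedMiddle 0ℓ → {A : Set} {P : A → Set} → ¬ (∀ a → P a) → ∃ λ a → ¬ P a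
¬∀⇒∃¬ em ¬∀ = em⇒dne em λ ¬∃ → ¬∀ λ a → em⇒dne em (¬∃⟶∀¬ ¬∃ a)

≗⇒AgreeUpTo : ∀ {p p'} m → p ≗ p' → AgreeUpTo m p p'
≗⇒AgreeUpTo m p≗p' i _ = p≗p' i

⊑⇒AgreeUpTo : ∀ w {p p'} → w ⊑ p → w ⊑ p' → AgreeUpTo (length w) p p'
⊑⇒AgreeUpTo (a ∷ w) (a≡p₀ , _) (a≡p'₀ , _) zero _ = trans (sym a≡p₀) a≡p'₀
⊑⇒AgreeUpTo (a ∷ w) (_ , w⊑p) (_ , w⊑p') (suc i) (s≤s i<∣w∣) =
  ⊑⇒AgreeUpTo w w⊑p w⊑p' i i<∣w∣

⊑-transport : ∀ w {p p'} → w ⊑ p → AgreeUpTo (length w) p p' → w ⊑ p'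
⊑-transport []      _             _     = tt
⊑-transport (a ∷ w) (a≡p₀ , w⊑p) p≈p' =
    trans a≡p₀ (p≈p' 0 (s≤s z≤n))
  , ⊑-transport w w⊑p (λ i i<∣w∣ → p≈p' (suc i) (s≤s i<∣w∣))

⊑-resp-≗ : ∀ w {p p'} → w ⊑ p → p ≗ p' → w ⊑ p'
⊑-resp-≗ w w⊑p p≗p' = ⊑-transport w w⊑p (≗⇒AgreeUpTo (length w) p≗p')

ΦGraph-resp-≗ : ∀ {q p p' v v'} → p ≗ p' → v ≗ v' → ΦGraph q p v → ΦGraph q p' v'
ΦGraph-resp-≗ {p = p} {p'} p≗p' v≗v' (consistent , unbounded) =
    (λ i c qi≡c in⊑p' →
       ⊑-resp-≗ (entryOut c) (consistent i c qi≡c (⊑-resp-≗ (entryIn c) in⊑p' p'≗p)) v≗v')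
  , λ n → let (i , c , qi≡c , in⊑p , n<∣out∣) = unbounded n
          in  i , c , qi≡c , ⊑-resp-≗ (entryIn c) in⊑p p≗p' , n<∣out∣
  where
  p'≗p : p' ≗ p
  p'≗p j = sym (p≗p' j)

app-resp-≗ : ∀ (f : PartialFunction) {p p'} (dp : dom f p) (dp' : dom f p') →
             p ≗ p' → app f p dp ≗ app f p' dp'
app-resp-≗ f dp dp' p≗p' = single-valued f dp dp' p≗p'

ΦGraph-entry : ∀ f {q p p'} (dp : dom f p) (dp' : dom f p') → p ≗ p' →
               ΦGraph q p (app f p dp) → ∀ {i c} → q i ≡ suc c →
               entryIn c ⊑ p' → entryOut c ⊑ app f p' dp'
ΦGraph-entry f dp dp' p≗p' φ {i} {c} =
  proj₁ (ΦGraph-resp-≗ p≗p' (app-resp-≗ f dp dp' p≗p') φ) i c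

module FirstHit (P : ℕ → Set) (P? : ∀ a → Dec (P a)) where

  IsFirstHit : Baire → ℕ → Set
  IsFirstHit q i = P (q i) × (∀ j → j < i → ¬ P (q j))

  firstHit : Baire → ℕ → Maybe ℕ
  firstHit q zero    = nothing
  firstHit q (suc k) = firstHit q k <∣> (if does (P? (q k)) then just k else nothing)

  firstHit-local : ∀ {q q'} k → AgreeUpTo k q q' → firstHit q k ≡ firstHit q' k
  firstHit-local zero    _     = refl
  firstHit-local (suc k) q≈q' =
    cong₂ _<∣>_ (firstHit-local k (λ i i<k → q≈q' i (m<n⇒m<1+n i<k)))
                (cong (λ a → if does (P? a) then just k else nothing) (q≈q' k ≤-refl))

  firstHit-nothing⇒ : ∀ q k → firstHit q k ≡ nothing → ∀ j → j < k → ¬ P (q j)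
  firstHit-nothing⇒ q (suc k) hit≡nothing j j<1+k with firstHit q k in e | P? (q k)
  ... | nothing | no ¬Pqk with m<1+n⇒m<n∨m≡n j<1+k
  ...   | inj₁ j<k  = firstHit-nothing⇒ q k e j j<k
  ...   | inj₂ refl = ¬Pqk
  firstHit-nothing⇒ q (suc k) () j j<1+k | nothing | yes _
  firstHit-nothing⇒ q (suc k) () j j<1+k | just _  | _

  firstHit-nothing⇐ : ∀ q k → (∀ j → j < k → ¬ P (q j)) → firstHit q k ≡ nothing
  firstHit-nothing⇐ q zero    _    = refl
  firstHit-nothing⇐ q (suc k) none
    rewrite firstHit-nothing⇐ q k (λ j j<k → none j (m<n⇒m<1+n j<k)) with P? (q k)
  ... | yes Pqk = contradiction Pqk (none k ≤-refl)
  ... | no _    = refl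

  firstHit-just⇒ : ∀ q k {i} → firstHit q k ≡ just i → i < k × IsFirstHit q i
  firstHit-just⇒ q (suc k) hit≡i with firstHit q k in e | P? (q k)
  ... | just _  | _ with hit≡i
  ...   | refl = let (i<k , first) = firstHit-just⇒ q k e in m<n⇒m<1+n i<k , first
  firstHit-just⇒ q (suc k) refl | nothing | yes Pqk = ≤-refl , Pqk , firstHit-nothing⇒ q k e
  firstHit-just⇒ q (suc k) ()   | nothing | no _

  firstHit-just⇐ : ∀ q k {i} → IsFirstHit q i → i < k → firstHit q k ≡ just i
  firstHit-just⇐ q (suc k) {i} first@(Pqi , before) i<1+k with m<1+n⇒m<n∨m≡n i<1+k
  ... | inj₁ i<k  rewrite firstHit-just⇐ q k first i<k = refl
  ... | inj₂ refl rewrite firstHit-nothing⇐ q i before with P? (q i)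
  ...   | yes _    = refl
  ...   | no ¬Pqi  = contradiction Pqi ¬Pqi

module Switch (P : ℕ → Set) (P? : ∀ a → Dec (P a)) (x : Baire) (z : ℕ → ℕ → Baire) where

  open FirstHit P P?

  switch : Baire → Baire
  switch q j = maybe (λ i → z i (q i) j) (x j) (firstHit q (suc j))

  switch-local : ∀ {q q'} j → AgreeUpTo (suc j) q q' → switch q j ≡ switch q' j
  switch-local {q} j q≈q' with firstHit q (suc j) in e
  ... | nothing = cong (maybe _ (x j)) (trans (sym e) (firstHit-local (suc j) q≈q'))
  ... | just i  = trans (cong (λ a → z i a j) (q≈q' i (proj₁ (firstHit-just⇒ q (suc j) e))))
                        (cong (maybe _ (x j)) (trans (sym e) (firstHit-local (suc j) q≈q')))

  switch-continuous : ContinuousTotal switch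
  switch-continuous q n = n , λ q' q≈q' j j<n →
    switch-local j (λ i i<1+j → q≈q' i (<-≤-trans i<1+j j<n))

  switch-cases : ExcludedMiddle 0ℓ → (∀ i a → AgreeUpTo i x (z i a)) → ∀ q →
                 ((∀ i → ¬ P (q i)) × switch q ≗ x) ⊎
                 (∃ λ i → P (q i) × switch q ≗ z i (q i))
  switch-cases em z-agrees q with em {∃ λ i → P (q i)}
  ... | no ¬hit = inj₁ (¬∃⟶∀¬ ¬hit , λ j →
          cong (maybe _ (x j)) (firstHit-nothing⇐ q (suc j) (λ i _ → ¬∃⟶∀¬ ¬hit i)))
  ... | yes (k , Pqk) with firstHit q (suc k) in e
  ...   | nothing = contradiction Pqk (firstHit-nothing⇒ q (suc k) e k ≤-refl)
  ...   | just i  = inj₂ (i , proj₁ first , switch≗z)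
    where
    first : IsFirstHit q i
    first = proj₂ (firstHit-just⇒ q (suc k) e)

    switch≗z : switch q ≗ z i (q i)
    switch≗z j with j <? i
    ... | yes j<i = trans
            (cong (maybe _ (x j)) (firstHit-nothing⇐ q (suc j)
              (λ j' j'<1+j → proj₂ first j' (<-≤-trans j'<1+j j<i))))
            (z-agrees i (q i) j j<i)
    ... | no j≮i  = cong (maybe _ (x j)) (firstHit-just⇐ q (suc j) first (s≤s (≮⇒≥ j≮i)))

record DiscontinuityAt (f : PartialFunction) (x : Baire) (dx : dom f x) (n : ℕ) : Set where
  field
    near           : ℕ → Baire
    near-dom       : ∀ m → dom f (near m)
    near-agrees    : ∀ m → AgreeUpTo m x (near m)
    near-separated : ∀ m → ¬ AgreeUpTo n (app f x dx) (app f (near m) (near-dom m))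

¬Continuous⇒DiscontinuityAt : ExcludedMiddle 0ℓ → ∀ f → ¬ Continuous f →
                              ∃ λ x → Σ (dom f x) λ dx → ∃ λ n → DiscontinuityAt f x dx n
¬Continuous⇒DiscontinuityAt em f ¬cont =
  let (x , ¬cont-x)     = ¬∀⇒∃¬ em ¬cont
      (dx , ¬cont-x-dx) = ¬∀⇒∃¬ em ¬cont-x
      (n , ¬modulus)    = ¬∀⇒∃¬ em ¬cont-x-dx
      counterexample m  = ¬∀⇒∃¬ em (¬∃⟶∀¬ ¬modulus m)
      counterexample-dom m = ¬∀⇒∃¬ em (proj₂ (counterexample m))
      separation m      = ¬∀⇒∃¬ em (proj₂ (counterexample-dom m))
  in x , dx , n , record
    { near           = λ m → proj₁ (counterexample m)
    ; near-dom       = λ m → proj₁ (counterexample-dom m)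
    ; near-agrees    = λ m → proj₁ (separation m)
    ; near-separated = λ m → proj₂ (separation m)
    }

module EffectiveDiscontinuity
  (em : ExcludedMiddle 0ℓ) (f : PartialFunction) {x : Baire} {dx : dom f x} {n : ℕ}
  (disc : DiscontinuityAt f x dx n) where

  open DiscontinuityAt disc

  Relevant : ℕ → Set
  Relevant zero    = ⊥
  Relevant (suc c) = entryIn c ⊑ x × n < length (entryOut c)

  target : ℕ → ℕ → Baire
  target i zero    = x
  target i (suc c) =
    if does (em {entryOut c ⊑ app f x dx}) then near (i + length (entryIn c)) else x

  target-cases : ∀ i c →
    (entryOut c ⊑ app f x dx × target i (suc c) ≡ near (i + length (entryIn c))) ⊎
    (¬ entryOut c ⊑ app f x dx × target i (suc c) ≡ x)
  target-cases i c with em {entryOut c ⊑ app f x dx}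
  ... | yes out⊑fx  = inj₁ (out⊑fx , refl)
  ... | no  out⋢fx  = inj₂ (out⋢fx , refl)

  target-agrees : ∀ i a → AgreeUpTo i x (target i a)
  target-agrees i zero    _ _ = refl
  target-agrees i (suc c) with target-cases i c
  ... | inj₁ (_ , t≡near) = subst (AgreeUpTo i x) (sym t≡near)
          λ j j<i → near-agrees (i + length (entryIn c)) j (<-≤-trans j<i (m≤m+n i _))
  ... | inj₂ (_ , t≡x)    = subst (AgreeUpTo i x) (sym t≡x) λ _ _ → refl

  target-dom : ∀ i a → dom f (target i a)
  target-dom i zero = dx
  target-dom i (suc c) with target-cases i c
  ... | inj₁ (_ , t≡near) = subst (dom f) (sym t≡near) (near-dom (i + length (entryIn c)))
  ... | inj₂ (_ , t≡x)    = subst (dom f) (sym t≡x) dx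

  open Switch Relevant (λ _ → em) x target

  switch-dom : ∀ q → dom f (switch q)
  switch-dom q with switch-cases em target-agrees q
  ... | inj₁ (_ , s≗x)     = dom-ext f (λ j → sym (s≗x j)) dx
  ... | inj₂ (i , _ , s≗t) = dom-ext f (λ j → sym (s≗t j)) (target-dom i (q i))

  switch-irrelevant-¬ΦGraph : ∀ q (dq : dom f (switch q)) → (∀ i → ¬ Relevant (q i)) →
                              switch q ≗ x → ¬ ΦGraph q (switch q) (app f (switch q) dq)
  switch-irrelevant-¬ΦGraph q dq irrelevant s≗x φ =
    let (i , c , qi≡c , in⊑x , n<∣out∣) =
          proj₂ (ΦGraph-resp-≗ s≗x (app-resp-≗ f dq dx s≗x) φ) n
    in  irrelevant i (subst Relevant (sym qi≡c) (in⊑x , n<∣out∣))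

  switch-relevant-¬ΦGraph : ∀ q (dq : dom f (switch q)) {i c} → q i ≡ suc c →
                            Relevant (suc c) → switch q ≗ target i (suc c) →
                            ¬ ΦGraph q (switch q) (app f (switch q) dq)
  switch-relevant-¬ΦGraph q dq {i} {c} qi≡c (in⊑x , n<∣out∣) s≗t φ with target-cases i c
  ... | inj₁ (out⊑fx , t≡near) = near-separated m λ j j<n →
          ⊑⇒AgreeUpTo (entryOut c) out⊑fx out⊑fnear j (<-trans j<n n<∣out∣)
    where
    m = i + length (entryIn c)
    in⊑near : entryIn c ⊑ near m
    in⊑near = ⊑-transport (entryIn c) in⊑x
                λ j j<∣in∣ → near-agrees m j (<-≤-trans j<∣in∣ (m≤n+m _ i))
    out⊑fnear : entryOut c ⊑ app f (near m) (near-dom m)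
    out⊑fnear = ΦGraph-entry f dq (near-dom m) (λ j → trans (s≗t j) (cong-app t≡near j))
                  φ qi≡c in⊑near
  ... | inj₂ (out⋢fx , t≡x) =
          out⋢fx (ΦGraph-entry f dq dx (λ j → trans (s≗t j) (cong-app t≡x j)) φ qi≡c in⊑x)

  switch-¬ΦGraph : ∀ q → ¬ ΦGraph q (switch q) (app f (switch q) (switch-dom q))
  switch-¬ΦGraph q with switch-cases em target-agrees q
  ... | inj₁ (irrelevant , s≗x) = switch-irrelevant-¬ΦGraph q _ irrelevant s≗x
  ... | inj₂ (i , rel , s≗t) with q i in qi≡a
  ...   | zero  = ⊥-elim rel
  ...   | suc c = switch-relevant-¬ΦGraph q _ qi≡a rel s≗t

  effectivelyDiscontinuous : EffectivelyDiscontinuous f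
  effectivelyDiscontinuous = switch , switch-continuous , switch-dom , switch-¬ΦGraph

proposition24 : ExcludedMiddle 0ℓ → (f : PartialFunction) →
                Continuous f ⊎ EffectivelyDiscontinuous f
proposition24 em f with em {Continuous f}
... | yes continuous  = inj₁ continuous
... | no ¬continuous  =
  let (_ , _ , _ , disc) = ¬Continuous⇒DiscontinuityAt em f ¬continuous
  in  inj₂ (EffectiveDiscontinuity.effectivelyDiscontinuous em f disc)
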